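{- Let $\alpha$ be a composition, $n\ge1$, and $\beta$ a composition with $\alpha<_c\beta$ such that $\beta/\!\!/\alpha$ is an nc border strip of size $n$. If $w\in CRHW_n$ satisfies $w(\alpha)=\beta$ and $j\in SE(\beta/\!\!/\alpha)$, then $j\notin\mathrm{leg}(w)$.
   Context: A composition is a finite sequence $\alpha=(\alpha_1,\ldots,\alpha_k)$ of positive integers; $l(\alpha)=k$, $|\alpha|=\sum\alpha_i$; its diagram is the set of boxes $(i,j)$ with $1\le i\le k$, $1\le j\le\alpha_i$ (rows top to bottom, columns left to right). Write $\alpha\lessdot_c\beta$ if $\beta=(1,\alpha_1,\ldots,\alpha_k)$, or $\beta$ is obtained from $\alpha$ by increasing a part $\alpha_m$ by one where $\alpha_i\ne\alpha_m$ for all $i<m$; $<_c$ is the transitive closure. If $\alpha<_c\beta$ and $d=l(\beta)-l(\alpha)$, $\beta/\!\!/\alpha$ is the set of boxes of the diagram of $\beta$ not of the form $(i'+d,j)$ with $j\le\alpha_{i'}$; its size is $|\beta|-|\alpha|$; it is an interval shape if the set of columns containing its boxes is a set of consecutive integers. An interval shape is an nc border strip if (1) whenever $(i,1),(i,2)\in\beta/\!\!/\alpha$, $(i,1)$ is the bottommost box of column 1 of $\beta/\!\!/\alpha$; (2) whenever $(i,j),(i,j+1)\in\beta/\!\!/\alpha$ with $j\ge2$, $(i,j)$ is the topmost box of column $j$ of $\beta/\!\!/\alpha$. $E(\beta/\!\!/\alpha)$ is the set of $j$ with $(i,j),(i,j+1)\in\beta/\!\!/\alpha$ for some $i$; $SE(\beta/\!\!/\alpha)$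 is the set of $j\notin E(\beta/\!\!/\alpha)$ such that there are boxes $(i,j),(i',j+1)\in\beta/\!\!/\alpha$ with $i'>i$. Box-adding operators: $\mathfrak{t}_1(\alpha)=(1,\alpha_1,\ldots,\alpha_k)$; for $i\ge2$, $\mathfrak{t}_i(\alpha)$ increases by one the leftmost part equal to $i-1$ if one exists, else is $0$; $\mathfrak{t}_i(0)=0$. A word $w=\mathfrak{t}_{i_1}\cdots\mathfrak{t}_{i_n}$ acts by $w(\alpha)=\mathfrak{t}_{i_1}(\cdots\mathfrak{t}_{i_n}(\alpha)\cdots)$. For $0\le k\le n-1$ it is a reverse $k$-hookword if $i_1\le\cdots\le i_{k+1}>i_{k+2}>\cdots>i_n$; then $\mathrm{leg}(w)=\{i_{k+1},\ldots,i_n\}$. It is connected if $\{i_1,\ldots,i_n\}$ is a set of consecutive integers; $CRHW_n$ is the set of connected reverse hookwords of length $n$. -}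

module Defs where

open import Data.Nat using (ℕ; zero; suc; _+_; _∸_; _≤_; _<_; _>_; _≟_)
open import Data.List using (List; []; _∷_; _++_; length)
open import Data.List.Membership.Propositional using (_∈_; _∉_)
open import Data.List.Relation.Unary.All using (All)
open import Data.List.Relation.Unary.Linked using (Linked)
open import Data.Maybe using (Maybe; just; nothing; _>>=_)
open import Data.Product using (_×_; ∃; ∃-syntax; Σ-syntax)
open import Relation.Nullary using (¬_; yes; no)
open import Relation.Binary.PropositionalEquality using (_≡_)
open import Relation.Binary.Construct.Closure.Transitive using (TransClosure)

IsComp : List ℕ → Set
IsComp α = All (λ x → 1 ≤ x) α

-- part α i = α_i (1-indexed); 0 if out of range.
part : List ℕ → ℕ → ℕ
part []       _             = 0
part (x ∷ xs) zero          = 0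
part (x ∷ xs) (suc zero)    = x
part (x ∷ xs) (suc (suc i)) = part xs (suc i)

InDiag : List ℕ → ℕ → ℕ → Set
InDiag α i j = (1 ≤ i) × (i ≤ length α) × (1 ≤ j) × (j ≤ part α i)

data _⋖c_ : List ℕ → List ℕ → Set where
  prepend1 : ∀ α → α ⋖c (1 ∷ α)
  incr     : ∀ xs x ys → x ∉ xs → (xs ++ (x ∷ ys)) ⋖c (xs ++ (suc x ∷ ys))

_<c_ : List ℕ → List ℕ → Set
_<c_ = TransClosure _⋖c_

InSkew : List ℕ → List ℕ → ℕ → ℕ → Set
InSkew α β i j =
  InDiag β i j × ¬ (∃[ i' ] (i ≡ i' + (length β ∸ length α)) × InDiag α i' j)

IsIntervalShape : List ℕ → List ℕ → Set
IsIntervalShape α β =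
  ∀ j₁ j j₂ → j₁ ≤ j → j ≤ j₂ →
  (∃[ i ] InSkew α β i j₁) → (∃[ i ] InSkew α β i j₂) → ∃[ i ] InSkew α β i j

IsNCBorderStrip : List ℕ → List ℕ → Set
IsNCBorderStrip α β =
  IsIntervalShape α β
  × (∀ i → InSkew α β i 1 → InSkew α β i 2 →
       ∀ i' → InSkew α β i' 1 → i' ≤ i)
  × (∀ i j → 2 ≤ j → InSkew α β i j → InSkew α β i (suc j) →
       ∀ i' → InSkew α β i' j → i ≤ i')

InE : List ℕ → List ℕ → ℕ → Set
InE α β j = ∃[ i ] InSkew α β i j × InSkew α β i (suc j)

InSE : List ℕ → List ℕ → ℕ → Set
InSE α β j = ¬ InE α β j ×
  (∃[ i ] ∃[ i' ] InSkew α β i j × InSkew α β i' (suc j) × i < i')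

incLeftmost : ℕ → List ℕ → Maybe (List ℕ)
incLeftmost k [] = nothing
incLeftmost k (x ∷ xs) with x ≟ k
... | yes _ = just (suc x ∷ xs)
... | no  _ = incLeftmost k xs Data.Maybe.>>= λ ys → just (x ∷ ys)

-- box-adding operator t_i (nothing plays the role of 0); t_0 unused
t : ℕ → Maybe (List ℕ) → Maybe (List ℕ)
t _ nothing = nothing
t zero (just α) = nothing
t (suc zero) (just α) = just (1 ∷ α)
t (suc (suc k)) (just α) = incLeftmost (suc k) α

act : List ℕ → Maybe (List ℕ) → Maybe (List ℕ)
act []      a = a
act (i ∷ w) a = t i (act w a)

-- w = u ++ (x ∷ v) is a reverse k-hookword with k = length u:
-- u ++ [x] weakly increasing, x ∷ v strictly decreasing; leg(w) = x ∷ v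
IsRevHookSplit : List ℕ → List ℕ → ℕ → List ℕ → Set
IsRevHookSplit w u x v =
  (w ≡ u ++ (x ∷ v)) × Linked _≤_ (u ++ (x ∷ [])) × Linked _>_ (x ∷ v)

IsRevHookword : List ℕ → Set
IsRevHookword w = ∃[ u ] ∃[ x ] ∃[ v ] IsRevHookSplit w u x v

IsConnected : List ℕ → Set
IsConnected w = ∀ a b c → a ∈ w → c ∈ w → a ≤ b → b ≤ c → b ∈ w

InCRHW : ℕ → List ℕ → Set
InCRHW n w = All (λ i → 1 ≤ i) w × length w ≡ n × IsRevHookword w × IsConnected w

-- Apply the letters of w one at a time, rightmost first, and watch the new boxes in
-- columns j and j + 1.  Writing the leg as L₁ j L₂, every letter of L₂ is below j and
-- adds no box in a column ≥ j; then t_j adds a box (r , j) with row r of length j and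
-- no row of length j - 1 above it.  The remaining letters of the leg and the part of the
-- arm that is ≥ j keep the picture: a later column-j box lies below r, and a column-(j+1)
-- box lies at or above r, hence strictly above r unless it lands in row r itself, which
-- puts j in E.  The letters of the arm below j add no box in columns j, j + 1 (t₁ only
-- shifts the rows).  So either j ∈ E, or every box of column j + 1 lies strictly above
-- every box of column j; both rule out j ∈ SE.
module Submission where

open import Defs
open import Data.Nat using (ℕ; zero; suc; pred; _+_; _∸_; _≤_; _<_; _>_; _≟_; _<?_; z≤n; s≤s; s≤s⁻¹)
open import Data.Nat.Properties
open import Data.Nat.ListAction using (sum)
open import Data.List using (List; []; _∷_; _++_; length; replicate)
open import Data.List.Properties using (++-assoc)
open import Data.List.Membership.Propositional using (_∈_; _∉_)
open import Data.List.Membership.Propositional.Properties using (∈-++⁺ʳ)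
open import Data.List.Relation.Unary.All as All using (All; []; _∷_)
import Data.List.Relation.Unary.All.Properties as All
open import Data.List.Relation.Unary.Any using (here; there)
open import Data.List.Relation.Unary.Linked as Linked using (Linked; []; [-]; _∷_)
open import Data.List.Relation.Unary.Linked.Properties using (Linked⇒All)
open import Data.Maybe using (just; nothing)
open import Data.Product using (_×_; _,_; ∃; ∃-syntax; proj₂)
open import Data.Sum as Sum using (_⊎_; inj₁; inj₂)
open import Data.Empty using (⊥; ⊥-elim)
open import Function using (_∘_)
open import Relation.Nullary using (¬_; yes; no)
open import Relation.Binary.Definitions using (Transitive)
open import Relation.Binary.PropositionalEquality
  using (_≡_; _≢_; refl; sym; trans; cong; subst; subst₂; module ≡-Reasoning)

part-suc : ∀ x xs {i} → 1 ≤ i → part (x ∷ xs) (suc i) ≡ part xs i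
part-suc x xs {suc i} _ = refl

part-zero : ∀ xs → part xs 0 ≡ 0
part-zero []       = refl
part-zero (x ∷ xs) = refl

1≤part⇒inRange : ∀ xs i → 1 ≤ part xs i → 1 ≤ i × i ≤ length xs
1≤part⇒inRange []       i             ()
1≤part⇒inRange (x ∷ xs) zero          ()
1≤part⇒inRange (x ∷ xs) (suc zero)    _  = s≤s z≤n , s≤s z≤n
1≤part⇒inRange (x ∷ xs) (suc (suc i)) p  = s≤s z≤n , s≤s (proj₂ (1≤part⇒inRange xs (suc i) p))

record IncrementedAt (k : ℕ) (P P' : List ℕ) (m : ℕ) : Set where
  field
    1≤m       : 1 ≤ m
    old       : part P m ≡ k
    leftmost  : ∀ i → 1 ≤ i → i < m → part P i ≢ k
    new       : part P' m ≡ suc k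
    unchanged : ∀ i → i ≢ m → part P' i ≡ part P i

incLeftmost-just : ∀ {k} P {P'} → incLeftmost k P ≡ just P' → ∃ (IncrementedAt k P P')
incLeftmost-just [] ()
incLeftmost-just {k} (x ∷ xs) eq with x ≟ k
incLeftmost-just (x ∷ xs) refl | yes x≡k = 1 , record
  { 1≤m       = s≤s z≤n
  ; old       = x≡k
  ; leftmost  = λ _ 1≤i i<1 → ⊥-elim (<⇒≱ i<1 1≤i)
  ; new       = cong suc x≡k
  ; unchanged = λ { zero _ → refl ; (suc zero) i≢1 → ⊥-elim (i≢1 refl) ; (suc (suc i)) _ → refl }
  }
... | no x≢k with incLeftmost k xs in e
incLeftmost-just {k} (x ∷ xs) refl | no x≢k | just ys with incLeftmost-just xs e
... | m , inc = suc m , record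
  { 1≤m       = s≤s z≤n
  ; old       = trans (part-suc x xs 1≤m) old
  ; leftmost  = leftmost′
  ; new       = trans (part-suc x ys 1≤m) new
  ; unchanged = unchanged′
  }
  where
  open IncrementedAt inc
  leftmost′ : ∀ i → 1 ≤ i → i < suc m → part (x ∷ xs) i ≢ k
  leftmost′ (suc zero)    _ _           = x≢k
  leftmost′ (suc (suc i)) _ (s≤s i<m) = leftmost (suc i) (s≤s z≤n) i<m
  unchanged′ : ∀ i → i ≢ suc m → part (x ∷ ys) i ≡ part (x ∷ xs) i
  unchanged′ zero          _  = refl
  unchanged′ (suc zero)    _  = refl
  unchanged′ (suc (suc i)) ne = unchanged (suc i) (ne ∘ cong suc)

incLeftmost-length : ∀ {k} P {P'} → incLeftmost k P ≡ just P' → length P' ≡ length P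
incLeftmost-length [] ()
incLeftmost-length {k} (x ∷ xs) eq with x ≟ k
incLeftmost-length (x ∷ xs) refl | yes _ = refl
... | no _ with incLeftmost k xs in e
incLeftmost-length (x ∷ xs) refl | no _ | just ys = cong suc (incLeftmost-length xs e)

IncrementedAt⇒≤ : ∀ {k P P' m} → IncrementedAt k P P' m → ∀ i → part P i ≤ part P' i
IncrementedAt⇒≤ {k} {m = m} inc i with i ≟ m
... | yes refl = subst₂ _≤_ (sym (IncrementedAt.old inc)) (sym (IncrementedAt.new inc)) (n≤1+n k)
... | no i≢m   = ≤-reflexive (sym (IncrementedAt.unchanged inc i i≢m))

-- Next to the current composition P a run keeps the original row lengths O: α with a
-- row of length 0 prepended for each t₁, so that O_i is the row of α that P_i grew from.
data Step : ℕ → List ℕ → List ℕ → List ℕ → List ℕ → Set where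
  t₁ : ∀ {O P} → Step 1 O P (0 ∷ O) (1 ∷ P)
  tₖ : ∀ {k O P P'} → incLeftmost (suc k) P ≡ just P' → Step (suc (suc k)) O P O P'

data Run : List ℕ → List ℕ → List ℕ → List ℕ → List ℕ → Set where
  done : ∀ {O P} → Run [] O P O P
  step : ∀ {c w O P O₁ P₁ O₂ P₂} → Run w O P O₁ P₁ → Step c O₁ P₁ O₂ P₂ → Run (c ∷ w) O P O₂ P₂

act⇒Run : ∀ w {P P'} O → act w (just P) ≡ just P' → ∃[ O' ] Run w O P O' P'
act⇒Run []      O refl = O , done
act⇒Run (c ∷ w) {P} O eq with act w (just P) in e
act⇒Run (c ∷ w) O () | nothing
act⇒Run (c ∷ w) O eq | just P₁ with act⇒Run w O e
act⇒Run (zero ∷ w)        O ()   | just P₁ | O₁ , run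
act⇒Run (suc zero ∷ w)    O refl | just P₁ | O₁ , run = 0 ∷ O₁ , step run t₁
act⇒Run (suc (suc k) ∷ w) O eq   | just P₁ | O₁ , run = O₁ , step run (tₖ eq)

Run-++⁻ : ∀ w₁ {w₂ O P O' P'} → Run (w₁ ++ w₂) O P O' P' →
  ∃[ O₁ ] ∃[ P₁ ] Run w₂ O P O₁ P₁ × Run w₁ O₁ P₁ O' P'
Run-++⁻ []       {O' = O'} {P'} run = O' , P' , run , done
Run-++⁻ (c ∷ w₁) (step run s) with Run-++⁻ w₁ run
... | O₁ , P₁ , run₂ , run₁ = O₁ , P₁ , run₂ , step run₁ s

Run-shape : ∀ {w α O P} → Run w α α O P → ∃[ d ] O ≡ replicate d 0 ++ α × length P ≡ d + length α
Run-shape done = 0 , refl , refl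
Run-shape (step run t₁) with Run-shape run
... | d , refl , len = suc d , refl , cong suc len
Run-shape (step run (tₖ {P = P} e)) with Run-shape run
... | d , eq , len = d , eq , trans (incLeftmost-length P e) len

StepPreserves : (ℕ → Set) → (List ℕ → List ℕ → Set) → Set
StepPreserves Q I = ∀ {c O P O' P'} → Q c → Step c O P O' P' → I O P → I O' P'

Run-preserves : ∀ (Q : ℕ → Set) (I : List ℕ → List ℕ → Set) → StepPreserves Q I →
  ∀ {w O P O' P'} → All Q w → Run w O P O' P' → I O P → I O' P'
Run-preserves Q I preserves []       done         i = i
Run-preserves Q I preserves (q ∷ qs) (step run s) i = preserves q s (Run-preserves Q I preserves qs run i)

record NewBox (O P : List ℕ) (i c : ℕ) : Set where
  constructor _,_
  field
    fresh  : part O i < c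
    placed : c ≤ part P i

NewBox⇒1≤i : ∀ {O P i c} → NewBox O P i c → 1 ≤ i
NewBox⇒1≤i {O} {P} {zero} {c} (O<c , c≤P) =
  ⊥-elim (<⇒≱ (subst (_< c) (part-zero O) O<c) (subst (c ≤_) (part-zero P) c≤P))
NewBox⇒1≤i {i = suc i} _ = s≤s z≤n

newBox-after-t₁ : ∀ {O P i c} → NewBox (0 ∷ O) (1 ∷ P) i c →
  (i ≡ 1 × c ≡ 1) ⊎ ∃[ i' ] i ≡ suc i' × NewBox O P i' c
newBox-after-t₁ {i = zero}        nb          = ⊥-elim (n≮0 (NewBox⇒1≤i nb))
newBox-after-t₁ {i = suc zero}    (0<c , c≤1) = inj₁ (refl , ≤-antisym c≤1 0<c)
newBox-after-t₁ {i = suc (suc i)} (O<c , c≤P) = inj₂ (suc i , refl , (O<c , c≤P))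

newBox-after-increment : ∀ {k O P P' m i c} → IncrementedAt k P P' m → NewBox O P' i c →
  NewBox O P i c ⊎ (i ≡ m × c ≡ suc k)
newBox-after-increment {m = m} {i} {c} inc (O<c , c≤P') with i ≟ m
... | no i≢m = inj₁ (O<c , subst (c ≤_) (IncrementedAt.unchanged inc i i≢m) c≤P')
... | yes refl with m≤n⇒m<n∨m≡n (subst (c ≤_) (IncrementedAt.new inc) c≤P')
...   | inj₁ c<1+k = inj₁ (O<c , subst (c ≤_) (sym (IncrementedAt.old inc)) (s≤s⁻¹ c<1+k))
...   | inj₂ c≡1+k = inj₂ (refl , c≡1+k)

-- j ∈ E: some row gained boxes in both columns j and j + 1.
Horizontal : ℕ → List ℕ → List ℕ → Set
Horizontal j O P = ∃[ i ] part O i < j × suc j ≤ part P i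

horizontal-step : ∀ {j c O P O' P'} → Step c O P O' P' → Horizontal j O P → Horizontal j O' P'
horizontal-step {j} {P = P} t₁ (zero , _ , j<P₀) = ⊥-elim (n≮0 (subst (suc j ≤_) (part-zero P) j<P₀))
horizontal-step t₁ (suc i , O<j , j<P) = suc (suc i) , O<j , j<P
horizontal-step (tₖ {P = P} e) (i , O<j , j<P) with incLeftmost-just P e
... | _ , inc = i , O<j , ≤-trans j<P (IncrementedAt⇒≤ inc i)

SuccColumnAbove : ℕ → List ℕ → List ℕ → Set
SuccColumnAbove j O P = ∀ i i' → NewBox O P i j → NewBox O P i' (suc j) → i' < i

Separated : ℕ → List ℕ → List ℕ → Set
Separated j O P = SuccColumnAbove j O P ⊎ Horizontal j O P

separated-step : ∀ {j} → StepPreserves (_< j) (Separated j)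
separated-step _ s (inj₂ h) = inj₂ (horizontal-step s h)
separated-step {j} {O = O} {P} 1<j t₁ (inj₁ above) = inj₁ above′
  where
  above′ : SuccColumnAbove j (0 ∷ O) (1 ∷ P)
  above′ i i' nb nb' with newBox-after-t₁ nb | newBox-after-t₁ nb'
  ... | inj₁ (_ , refl)       | _                     = ⊥-elim (<-irrefl refl 1<j)
  ... | inj₂ _                | inj₁ (_ , refl)       = ⊥-elim (n≮0 1<j)
  ... | inj₂ (a , refl , nbA) | inj₂ (b , refl , nbB) = s≤s (above a b nbA nbB)
separated-step {j} {O = O} c<j (tₖ {P = P} {P'} e) (inj₁ above) with incLeftmost-just P e
... | _ , inc = inj₁ λ i i' nb nb' → above i i' (oldBox ≤-refl nb) (oldBox (n≤1+n j) nb')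
  where
  oldBox : ∀ {i c} → j ≤ c → NewBox O P' i c → NewBox O P i c
  oldBox j≤c nb with newBox-after-increment inc nb
  ... | inj₁ nb′        = nb′
  ... | inj₂ (_ , refl) = ⊥-elim (<⇒≱ c<j j≤c)

record UntouchedFrom (j : ℕ) (O P : List ℕ) : Set where
  field
    grown : ∀ i → part O i ≤ part P i
    fixed : ∀ i → j ≤ part P i → part P i ≡ part O i

untouchedFrom-start : ∀ {j P} → UntouchedFrom j P P
untouchedFrom-start = record { grown = λ _ → ≤-refl ; fixed = λ _ _ → refl }

UntouchedFrom⇒¬NewBox : ∀ {j O P i c} → UntouchedFrom j O P → j ≤ c → ¬ NewBox O P i c
UntouchedFrom⇒¬NewBox {i = i} {c} u j≤c (O<c , c≤P) =
  <⇒≱ O<c (subst (c ≤_) (UntouchedFrom.fixed u i (≤-trans j≤c c≤P)) c≤P)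

untouchedFrom-step : ∀ {j} → StepPreserves (_< j) (UntouchedFrom j)
untouchedFrom-step 1<j t₁ u = record
  { grown = λ { zero → z≤n ; (suc zero) → z≤n ; (suc (suc i)) → grown (suc i) }
  ; fixed = λ { zero _ → refl ; (suc zero) j≤1 → ⊥-elim (<⇒≱ 1<j j≤1) ; (suc (suc i)) → fixed (suc i) }
  }
  where open UntouchedFrom u
untouchedFrom-step {j} {O = O} c<j (tₖ {P = P} {P'} e) u with incLeftmost-just P e
... | m , inc = record { grown = λ i → ≤-trans (grown i) (IncrementedAt⇒≤ inc i) ; fixed = fixed′ }
  where
  open UntouchedFrom u
  open IncrementedAt inc
  fixed′ : ∀ i → j ≤ part P' i → part P' i ≡ part O i
  fixed′ i j≤P' with i ≟ m
  ... | yes refl = ⊥-elim (<⇒≱ c<j (subst (j ≤_) new j≤P'))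
  ... | no i≢m   = trans (unchanged i i≢m) (fixed i (subst (j ≤_) (unchanged i i≢m) j≤P'))

-- r is the row in which t_j added its box.
record Pivot (j : ℕ) (O P : List ℕ) (r : ℕ) : Set where
  field
    fresh       : part O r < j
    reaches     : part P r ≡ j
    noneAbove   : ∀ i → 1 ≤ i → i < r → part P i ≢ pred j
    nextAbove   : ∀ i → NewBox O P i (suc j) → i < r
    columnBelow : ∀ i → NewBox O P i j → r ≤ i
    firstRow    : j ≡ 1 → r ≡ 1

  1≤r : 1 ≤ r
  1≤r = NewBox⇒1≤i {O} {P} (fresh , ≤-reflexive (sym reaches))

Pivot⇒SuccColumnAbove : ∀ {j O P r} → Pivot j O P r → SuccColumnAbove j O P
Pivot⇒SuccColumnAbove p i i' nb nb' = <-≤-trans (Pivot.nextAbove p i' nb') (Pivot.columnBelow p i nb)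

pivot-after-t₁ : ∀ {O P} → (∀ i → ¬ NewBox O P i 2) → Pivot 1 (0 ∷ O) (1 ∷ P) 1
pivot-after-t₁ {O} {P} noColumn2 = record
  { fresh       = s≤s z≤n
  ; reaches     = refl
  ; noneAbove   = λ _ 1≤i i<1 → ⊥-elim (<⇒≱ i<1 1≤i)
  ; nextAbove   = nextAbove
  ; columnBelow = λ _ → NewBox⇒1≤i
  ; firstRow    = λ _ → refl
  }
  where
  nextAbove : ∀ i → NewBox (0 ∷ O) (1 ∷ P) i 2 → i < 1
  nextAbove i nb with newBox-after-t₁ nb
  ... | inj₁ (_ , ())
  ... | inj₂ (i' , _ , nb′) = ⊥-elim (noColumn2 i' nb′)

pivot-intro : ∀ {j O P O' P'} → Step j O P O' P' → UntouchedFrom j O P → ∃ (Pivot j O' P')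
pivot-intro t₁ u = 1 , pivot-after-t₁ (λ _ → UntouchedFrom⇒¬NewBox u (s≤s z≤n))
pivot-intro {O = O} (tₖ {k} {P = P} {P'} e) u with incLeftmost-just P e
... | m , inc = m , record
  { fresh       = ≤-<-trans (subst (part O m ≤_) old (UntouchedFrom.grown u m)) (n<1+n (suc k))
  ; reaches     = new
  ; noneAbove   = λ i 1≤i i<m → leftmost i 1≤i i<m ∘ trans (sym (unchanged i (<⇒≢ i<m)))
  ; nextAbove   = nextAbove
  ; columnBelow = columnBelow
  ; firstRow    = λ ()
  }
  where
  open IncrementedAt inc
  nextAbove : ∀ i → NewBox O P' i (suc (suc (suc k))) → i < m
  nextAbove i nb with newBox-after-increment inc nb
  ... | inj₁ nb′     = ⊥-elim (UntouchedFrom⇒¬NewBox u (n≤1+n _) nb′)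
  ... | inj₂ (_ , e) = ⊥-elim (1+n≢n (suc-injective e))
  columnBelow : ∀ i → NewBox O P' i (suc (suc k)) → m ≤ i
  columnBelow i nb with newBox-after-increment inc nb
  ... | inj₁ nb′        = ⊥-elim (UntouchedFrom⇒¬NewBox u ≤-refl nb′)
  ... | inj₂ (refl , _) = ≤-refl

pivot-step-≡ : ∀ {j O P O' P' r} → Step j O P O' P' → Pivot j O P r → ∃ (Pivot j O' P')
pivot-step-≡ t₁ p = 1 , pivot-after-t₁ noColumn2
  where
  open Pivot p
  noColumn2 : ∀ i → ¬ NewBox _ _ i 2
  noColumn2 i nb = <⇒≱ (subst (i <_) (firstRow refl) (nextAbove i nb)) (NewBox⇒1≤i nb)
pivot-step-≡ {O = O} {r = r} (tₖ {k} {P = P} {P'} e) p with incLeftmost-just P e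
... | m , inc = r , record
  { fresh       = fresh
  ; reaches     = trans (unchanged r r≢m) reaches
  ; noneAbove   = noneAbove′
  ; nextAbove   = nextAbove′
  ; columnBelow = columnBelow′
  ; firstRow    = λ ()
  }
  where
  open Pivot p
  open IncrementedAt inc
  r≢m : r ≢ m
  r≢m refl = 1+n≢n (trans (sym reaches) old)
  noneAbove′ : ∀ i → 1 ≤ i → i < r → part P' i ≢ suc k
  noneAbove′ i 1≤i i<r with i ≟ m
  ... | yes refl = 1+n≢n ∘ trans (sym new)
  ... | no i≢m   = noneAbove i 1≤i i<r ∘ trans (sym (unchanged i i≢m))
  nextAbove′ : ∀ i → NewBox O P' i (suc (suc (suc k))) → i < r
  nextAbove′ i nb with newBox-after-increment inc nb
  ... | inj₁ nb′     = nextAbove i nb′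
  ... | inj₂ (_ , e) = ⊥-elim (1+n≢n (suc-injective e))
  columnBelow′ : ∀ i → NewBox O P' i (suc (suc k)) → r ≤ i
  columnBelow′ i nb with newBox-after-increment inc nb
  ... | inj₁ nb′        = columnBelow i nb′
  ... | inj₂ (refl , _) = ≮⇒≥ (λ m<r → noneAbove m 1≤m m<r old)

pivot-increment-elsewhere : ∀ {j k O P P' m r} → IncrementedAt (suc k) P P' m →
  j < suc (suc k) → m ≢ r → Pivot j O P r → Pivot j O P' r
pivot-increment-elsewhere {j} {k} {O} {P} {P'} {m} {r} inc j<c m≢r p = record
  { fresh       = fresh
  ; reaches     = trans (unchanged r (m≢r ∘ sym)) reaches
  ; noneAbove   = noneAbove′
  ; nextAbove   = nextAbove′
  ; columnBelow = columnBelow′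
  ; firstRow    = firstRow
  }
  where
  open Pivot p
  open IncrementedAt inc
  noneAbove′ : ∀ i → 1 ≤ i → i < r → part P' i ≢ pred j
  noneAbove′ i 1≤i i<r with i ≟ m
  ... | yes refl = λ q → <⇒≢ (≤-<-trans pred[n]≤n j<c) (trans (sym q) new)
  ... | no i≢m   = noneAbove i 1≤i i<r ∘ trans (sym (unchanged i i≢m))
  -- t_{j+1} adds its box to the leftmost row of length j, and row r has length j.
  nextAbove′ : ∀ i → NewBox O P' i (suc j) → i < r
  nextAbove′ i nb with newBox-after-increment inc nb
  ... | inj₁ nb′           = nextAbove i nb′
  ... | inj₂ (refl , j+1≡) =
    ≤∧≢⇒< (≮⇒≥ (λ r<m → leftmost r 1≤r r<m (trans reaches (suc-injective j+1≡)))) m≢r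
  columnBelow′ : ∀ i → NewBox O P' i j → r ≤ i
  columnBelow′ i nb with newBox-after-increment inc nb
  ... | inj₁ nb′        = columnBelow i nb′
  ... | inj₂ (_ , refl) = ⊥-elim (<-irrefl refl j<c)

pivot-step-< : ∀ {j c O P O' P' r} → j < c → Step c O P O' P' → Pivot j O P r →
  Pivot j O' P' r ⊎ Horizontal j O' P'
pivot-step-< (s≤s z≤n) t₁ p = ⊥-elim (n≮0 (Pivot.fresh p))
pivot-step-< {r = r} j<c (tₖ {P = P} e) p with incLeftmost-just P e
... | m , inc with m ≟ r
...   | yes refl = inj₂ (m , Pivot.fresh p , subst (_ ≤_) (sym (IncrementedAt.new inc)) j<c)
...   | no m≢r   = inj₁ (pivot-increment-elsewhere inc j<c m≢r p)

PivotOrHorizontal : ℕ → List ℕ → List ℕ → Set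
PivotOrHorizontal j O P = ∃ (Pivot j O P) ⊎ Horizontal j O P

pivotOrHorizontal-step : ∀ {j} → StepPreserves (j ≤_) (PivotOrHorizontal j)
pivotOrHorizontal-step _ s (inj₂ h) = inj₂ (horizontal-step s h)
pivotOrHorizontal-step j≤c s (inj₁ (r , p)) with m≤n⇒m<n∨m≡n j≤c
... | inj₁ j<c  = Sum.map₁ (r ,_) (pivot-step-< j<c s p)
... | inj₂ refl = inj₁ (pivot-step-≡ s p)

PivotOrHorizontal⇒Separated : ∀ {j O P} → PivotOrHorizontal j O P → Separated j O P
PivotOrHorizontal⇒Separated = Sum.map₁ (Pivot⇒SuccColumnAbove ∘ proj₂)

hookRun-separated : ∀ {j A M L O P O' P'} → All (_< j) A → All (j ≤_) M → All (_< j) L →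
  Run (A ++ M ++ j ∷ L) O P O' P' → UntouchedFrom j O P → Separated j O' P'
hookRun-separated {j} {A} {M} A<j M≥j L<j run untouched with Run-++⁻ A run
... | _ , _ , runMjL , runA with Run-++⁻ M runMjL
... | _ , _ , step runL tⱼ , runM =
  Run-preserves (_< j) (Separated j) separated-step A<j runA
    (PivotOrHorizontal⇒Separated
      (Run-preserves (j ≤_) (PivotOrHorizontal j) pivotOrHorizontal-step M≥j runM
        (inj₁ (pivot-intro tⱼ
          (Run-preserves (_< j) (UntouchedFrom j) untouchedFrom-step L<j runL untouched)))))

Linked⇒All-head : ∀ {A : Set} {R : A → A → Set} → Transitive R →
  ∀ {x xs} → Linked R (x ∷ xs) → All (R x) xs
Linked⇒All-head R-trans [-]        = []
Linked⇒All-head R-trans (Rxy ∷ lk) = Linked⇒All R-trans Rxy lk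

Linked-++⁻ˡ : ∀ {A : Set} {R : A → A → Set} xs {ys} → Linked R (xs ++ ys) → Linked R xs
Linked-++⁻ˡ []           _          = []
Linked-++⁻ˡ (x ∷ [])     _          = [-]
Linked-++⁻ˡ (x ∷ y ∷ xs) (Rxy ∷ lk) = Rxy ∷ Linked-++⁻ˡ (y ∷ xs) lk

>-trans : Transitive _>_
>-trans m>n n>o = <-trans n>o m>n

decreasing-split : ∀ {j l} → Linked _>_ l → j ∈ l →
  ∃[ L₁ ] ∃[ L₂ ] l ≡ L₁ ++ j ∷ L₂ × All (j <_) L₁ × All (_< j) L₂
decreasing-split lk (here refl) = [] , _ , refl , [] , Linked⇒All-head >-trans lk
decreasing-split {l = a ∷ _} lk (there j∈) with decreasing-split (Linked.tail lk) j∈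
... | L₁ , L₂ , refl , L₁>j , L₂<j =
  a ∷ L₁ , L₂ , refl , All.lookup (Linked⇒All-head >-trans lk) j∈ ∷ L₁>j , L₂<j

increasing-split : ∀ t {l} → Linked _≤_ l → ∃[ A ] ∃[ C ] l ≡ A ++ C × All (_< t) A × All (t ≤_) C
increasing-split t {[]} _ = [] , [] , refl , [] , []
increasing-split t {a ∷ l} lk with a <? t
... | no a≮t = [] , a ∷ l , refl , [] , Linked⇒All ≤-trans (≮⇒≥ a≮t) lk
... | yes a<t with increasing-split t (Linked.tail lk)
...   | A , C , refl , A<t , C≥t = a ∷ A , C , refl , a<t ∷ A<t , C≥t

hookword-factor : ∀ {w u x v j} → IsRevHookSplit w u x v → j ∈ x ∷ v →
  ∃[ A ] ∃[ M ] ∃[ L ] w ≡ A ++ M ++ j ∷ L × All (_< j) A × All (j ≤_) M × All (_< j) L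
hookword-factor {u = u} {x} {v} {j} (refl , u↗ , leg↘) j∈leg
  with decreasing-split leg↘ j∈leg | increasing-split j (Linked-++⁻ˡ u u↗)
... | L₁ , L₂ , leg≡ , L₁>j , L₂<j | A , C , refl , A<j , C≥j =
  A , C ++ L₁ , L₂ , w≡ , A<j , All.++⁺ C≥j (All.map <⇒≤ L₁>j) , L₂<j
  where
  open ≡-Reasoning
  w≡ : (A ++ C) ++ x ∷ v ≡ A ++ (C ++ L₁) ++ j ∷ L₂
  w≡ = begin
    (A ++ C) ++ x ∷ v            ≡⟨ cong ((A ++ C) ++_) leg≡ ⟩
    (A ++ C) ++ L₁ ++ j ∷ L₂     ≡⟨ ++-assoc A C _ ⟩
    A ++ C ++ L₁ ++ j ∷ L₂       ≡⟨ cong (A ++_) (sym (++-assoc C L₁ _)) ⟩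
    A ++ (C ++ L₁) ++ j ∷ L₂     ∎

≤part-shifted⇒InDiag : ∀ α d {i c} → 1 ≤ c → c ≤ part (replicate d 0 ++ α) i →
  ∃[ i' ] i ≡ i' + d × InDiag α i' c
≤part-shifted⇒InDiag α zero {i} 1≤c c≤ with 1≤part⇒inRange α i (≤-trans 1≤c c≤)
... | 1≤i , i≤l = i , sym (+-identityʳ i) , 1≤i , i≤l , 1≤c , c≤
≤part-shifted⇒InDiag α (suc d) {zero}     1≤c c≤ = ⊥-elim (<⇒≱ 1≤c c≤)
≤part-shifted⇒InDiag α (suc d) {suc zero} 1≤c c≤ = ⊥-elim (<⇒≱ 1≤c c≤)
≤part-shifted⇒InDiag α (suc d) {suc (suc i)} 1≤c c≤ with ≤part-shifted⇒InDiag α d 1≤c c≤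
... | i' , i≡ , D = i' , trans (cong suc i≡) (sym (+-suc i' d)) , D

InDiag⇒≤part-shifted : ∀ α d {i' c} → InDiag α i' c → c ≤ part (replicate d 0 ++ α) (i' + d)
InDiag⇒≤part-shifted α zero {i'} (_ , _ , _ , c≤) rewrite +-identityʳ i' = c≤
InDiag⇒≤part-shifted α (suc d) {i'} D@(1≤i' , _) rewrite +-suc i' d =
  subst (_ ≤_) (sym (part-suc 0 _ (≤-trans 1≤i' (m≤m+n i' d)))) (InDiag⇒≤part-shifted α d D)

InSkew⇒NewBox : ∀ {α β d i c} → length β ∸ length α ≡ d → 1 ≤ c →
  InSkew α β i c → NewBox (replicate d 0 ++ α) β i c
InSkew⇒NewBox {α} refl 1≤c ((_ , _ , _ , c≤β) , notOld) =
  ≰⇒> (notOld ∘ ≤part-shifted⇒InDiag α _ 1≤c) , c≤β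

NewBox⇒InSkew : ∀ {α β d i c} → length β ∸ length α ≡ d → 1 ≤ c →
  NewBox (replicate d 0 ++ α) β i c → InSkew α β i c
NewBox⇒InSkew {α} {β} {i = i} refl 1≤c (O<c , c≤β) with 1≤part⇒inRange β i (≤-trans 1≤c c≤β)
... | 1≤i , i≤l = (1≤i , i≤l , 1≤c , c≤β) , λ { (i' , refl , D) → <⇒≱ O<c (InDiag⇒≤part-shifted α (length β ∸ length α) {i'} D) }

separated⇒∉SE : ∀ {α β w O j} → 1 ≤ j → Run w α α O β → Separated j O β → ¬ InSE α β j
separated⇒∉SE {α} {β} {j = j} 1≤j run sep (j∉E , i , i' , ij , i'j+1 , i<i') with Run-shape run
... | d , refl , len = excluded sep
  where
  shift : length β ∸ length α ≡ d
  shift = trans (cong (_∸ length α) len) (m+n∸n≡m d (length α))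
  excluded : Separated j (replicate d 0 ++ α) β → ⊥
  excluded (inj₁ above) =
    <-asym i<i' (above i i' (InSkew⇒NewBox shift 1≤j ij) (InSkew⇒NewBox shift (s≤s z≤n) i'j+1))
  excluded (inj₂ (k , O<j , j<β)) = j∉E (k ,
    NewBox⇒InSkew {α} {β} {i = k} shift 1≤j (O<j , ≤-trans (n≤1+n j) j<β) ,
    NewBox⇒InSkew {α} {β} {i = k} shift (s≤s z≤n) (m<n⇒m<1+n O<j , j<β))

lemma5p11 : (α β : List ℕ) → IsComp α → IsComp β →
    (n : ℕ) → 1 ≤ n → α <c β → IsNCBorderStrip α β → sum β ≡ sum α + n →
    (w : List ℕ) → InCRHW n w → act w (just α) ≡ just β →
    (j : ℕ) → InSE α β j →
    ∀ u x v → IsRevHookSplit w u x v → j ∉ (x ∷ v)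
lemma5p11 α β _ _ _ _ _ _ _ w (letters≥1 , _) w·α≡β j j∈SE u x v split j∈leg
  with hookword-factor split j∈leg | act⇒Run w α w·α≡β
... | A , M , L , refl , A<j , M≥j , L<j | O , run =
  separated⇒∉SE 1≤j run (hookRun-separated A<j M≥j L<j run untouchedFrom-start) j∈SE
  where
  1≤j : 1 ≤ j
  1≤j = All.lookup letters≥1 (∈-++⁺ʳ A (∈-++⁺ʳ M (here refl)))
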